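{- Let $k\ge 1$ be a non-square integer, and let $x(n)$, $y(n)$ be the sequences such that $\{(x(n),y(n)):n\in\mathbb{N}\}$ is the set of solutions $(X,Y)\in\mathbb{N}^2$ of $X^2-kY^2=1$, with $(x(0),y(0))=(1,0)$ and $x$ strictly increasing. Then for every sufficiently large integer $b\ge 2$, the following identities hold for every integer $n\ge 1$: $$x(n)=\left\lfloor \frac{b^{n^2+2n}-x(1)b^{n^2+n}}{b^{2n}-2x(1)b^n+1}\right\rfloor \bmod b^n,\qquad y(n)=\left\lfloor \frac{y(1)b^{n^2+n}}{b^{2n}-2x(1)b^n+1}\right\rfloor \bmod b^n .$$
   Context: $\mathbb{N}$ denotes the set of non-negative integers. For $y\ge1$, $x\bmod y$ is the least non-negative residue of $x$ modulo $y$. -}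

module Defs where

open import Data.Nat using (ℕ; suc)
open import Data.Integer using (ℤ; +_; -[1+_]; -_; _/ℕ_)

-- ⌊ n / d ⌋ for integers n, d with d ≠ 0 (floor division, rounding towards -∞).
-- Junk value 0 when d = 0 (never used in the statement for large b).
floorDiv : ℤ → ℤ → ℤ
floorDiv n (+ 0)        = + 0
floorDiv n (+ (suc m))  = n /ℕ suc m
floorDiv n -[1+ m ]     = (- n) /ℕ suc m

-- least non-negative residue of an integer a modulo a positive natural m
-- (junk value 0 when m = 0; never used in the statement since m = b^n ≥ 2).
open import Data.Integer using (_%ℕ_)
_modℕ'_ : ℤ → ℕ → ℕ
a modℕ' 0       = 0
a modℕ' (suc m) = a %ℕ suc m

-- Let a = x 1, c = y 1 and m = 2a. Multiplication by a + c√k preserves the norm X² − kY²,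
-- and since a is the least X ≥ 2 occurring in a solution, multiplying a solution with X ≥ 2
-- by the conjugate a − c√k gives a strictly smaller solution. By descent the solutions are
-- the powers of a + c√k, so x and y both satisfy u (j + 2) + u j = m u (j + 1), i.e.
-- Σ u i z^i = (u 0 + (u 1 − m u 0) z) / (1 − m z + z²). With C = bⁿ the quotient in the
-- statement is Cⁿ times this series at z = 1/C: the base-C number with digits u 0, …, u n
-- plus a tail, which lies in [0, 1) once u (n + 1) + m ≤ C. That holds for b ≥ m² + m since
-- u (n + 1) ≤ m^(n+1), and then u n is the last digit of the integer part.
module Submission where

open import Defs
open import Data.Nat using (ℕ; zero; suc; _≤_; _<_; z≤n; s≤s; _≤?_; NonZero)
import Data.Nat as ℕ
import Data.Nat.Properties as ℕₚ
open import Data.Nat.DivMod using (_/_; _%_; +-distrib-/-∣ʳ; m<n⇒m/n≡0; m*n/n≡m; m<n⇒m%n≡m; [m+kn]%n≡m%n)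
open import Data.Nat.Divisibility using (n∣m*n)
open import Data.Nat.Induction using (<-wellFounded)
import Data.Nat.Tactic.RingSolver as ℕ-Solver
open import Data.Integer using (ℤ; +_)
import Data.Integer as ℤ
import Data.Integer.Properties as ℤₚ
open import Data.Integer.Tactic.RingSolver using (solve-∀)
open import Data.List using (_∷_; [])
open import Data.Product using (∃; _×_; _,_; proj₁; proj₂; map; map₂)
open import Data.Sum using (inj₁; inj₂)
open import Function.Bundles using (_⇔_; Equivalence)
open import Induction.WellFounded using (Acc; acc)
open import Relation.Binary.Core using (_Preserves_⟶_)
open import Relation.Binary.PropositionalEquality
open import Relation.Nullary using (yes; no; contradiction)

module _ where
  open import Data.Nat using (_+_; _*_; _∸_)

  m*m≤n*n⇒m≤n : ∀ {m n} → m * m ≤ n * n → m ≤ n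
  m*m≤n*n⇒m≤n mm≤nn = ℕₚ.≮⇒≥ (λ n<m → ℕₚ.<⇒≱ (ℕₚ.*-mono-< n<m n<m) mm≤nn)

  m*m<n*n⇒m<n : ∀ {m n} → m * m < n * n → m < n
  m*m<n*n⇒m<n mm<nn = ℕₚ.≰⇒> (λ n≤m → ℕₚ.<⇒≱ mm<nn (ℕₚ.*-mono-≤ n≤m n≤m))

  [m+kn]/n≡k : ∀ {m} k n .{{_ : NonZero n}} → m < n → (m + k * n) / n ≡ k
  [m+kn]/n≡k {m} k n m<n = trans (+-distrib-/-∣ʳ m (n∣m*n k)) (cong₂ _+_ (m<n⇒m/n≡0 m<n) (m*n/n≡m k n))

  pos-∸ : ∀ {m n} → n ≤ m → + (m ∸ n) ≡ + m ℤ.- + n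
  pos-∸ {m} {n} n≤m = sym (trans (ℤₚ.m-n≡m⊖n m n) (ℤₚ.⊖-≥ n≤m))

pos-^ : ∀ b n → + (b ℕ.^ n) ≡ (+ b) ℤ.^ n
pos-^ b zero    = refl
pos-^ b (suc n) = trans (ℤₚ.pos-* b (b ℕ.^ n)) (cong (+ b ℤ.*_) (pos-^ b n))

pos-^-* : ∀ b n {e f} → e ≡ n ℕ.* f → (+ b) ℤ.^ e ≡ (+ (b ℕ.^ n)) ℤ.^ f
pos-^-* b n {f = f} refl = trans (sym (ℤₚ.^-*-assoc (+ b) n f)) (cong (ℤ._^ f) (sym (pos-^ b n)))

module _ {f : ℕ → ℕ} (f-< : f Preserves _<_ ⟶ _<_) where

  strictMono⇒mono : f Preserves _≤_ ⟶ _≤_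
  strictMono⇒mono i≤j with ℕₚ.m≤n⇒m<n∨m≡n i≤j
  ... | inj₁ i<j  = ℕₚ.<⇒≤ (f-< i<j)
  ... | inj₂ refl = ℕₚ.≤-refl

  strictMono⇒reflects-< : ∀ {i j} → f i < f j → i < j
  strictMono⇒reflects-< fi<fj = ℕₚ.≰⇒> (λ j≤i → ℕₚ.<⇒≱ fi<fj (strictMono⇒mono j≤i))

  strictMono⇒injective : ∀ {i j} → f i ≡ f j → i ≡ j
  strictMono⇒injective fi≡fj = ℕₚ.≤-antisym
    (ℕₚ.≮⇒≥ (λ j<i → ℕₚ.<⇒≢ (f-< j<i) (sym fi≡fj)))
    (ℕₚ.≮⇒≥ (λ i<j → ℕₚ.<⇒≢ (f-< i<j) fi≡fj))

  strictMono⇒id≤ : ∀ n → n ≤ f n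
  strictMono⇒id≤ zero    = z≤n
  strictMono⇒id≤ (suc n) = ℕₚ.≤-<-trans (strictMono⇒id≤ n) (f-< (ℕₚ.n<1+n n))

<-suc⇒strictMono : ∀ {f : ℕ → ℕ} → (∀ j → f j < f (suc j)) → f Preserves _<_ ⟶ _<_
<-suc⇒strictMono f-suc {i} {suc j} (s≤s i≤j) with ℕₚ.m≤n⇒m<n∨m≡n i≤j
... | inj₁ i<j  = ℕₚ.<-trans (<-suc⇒strictMono f-suc i<j) (f-suc j)
... | inj₂ refl = f-suc j

strictMono-range⊆⇒≤ : ∀ {f g : ℕ → ℕ} → f Preserves _<_ ⟶ _<_ → g Preserves _<_ ⟶ _<_ →
                      (∀ j → ∃ λ i → g j ≡ f i) → ∀ n → f n ≤ g n
strictMono-range⊆⇒≤ {f} {g} f-< g-< g⊆f n = begin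
    f n         ≤⟨ strictMono⇒mono f-< (strictMono⇒id≤ index-< n) ⟩
    f (index n) ≡⟨ proj₂ (g⊆f n) ⟨
    g n         ∎
  where
  open ℕₚ.≤-Reasoning
  index : ℕ → ℕ
  index j = proj₁ (g⊆f j)
  index-< : index Preserves _<_ ⟶ _<_
  index-< {i} {j} i<j = strictMono⇒reflects-< f-< (subst₂ _<_ (proj₂ (g⊆f i)) (proj₂ (g⊆f j)) (g-< i<j))

strictMono-sameRange⇒≗ : ∀ {f g : ℕ → ℕ} → f Preserves _<_ ⟶ _<_ → g Preserves _<_ ⟶ _<_ →
                         (∀ i → ∃ λ j → f i ≡ g j) → (∀ j → ∃ λ i → g j ≡ f i) → f ≗ g
strictMono-sameRange⇒≗ f-< g-< f⊆g g⊆f n =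
  ℕₚ.≤-antisym (strictMono-range⊆⇒≤ f-< g-< g⊆f n) (strictMono-range⊆⇒≤ g-< f-< f⊆g n)

recurrence-≗ : ∀ {f g : ℕ → ℕ} {m} → f ≗ g → (∀ j → g (2 ℕ.+ j) ℕ.+ g j ≡ m ℕ.* g (1 ℕ.+ j)) →
               ∀ j → f (2 ℕ.+ j) ℕ.+ f j ≡ m ℕ.* f (1 ℕ.+ j)
recurrence-≗ {m = m} f≗g g-rec j =
  trans (cong₂ ℕ._+_ (f≗g (2 ℕ.+ j)) (f≗g j)) (trans (g-rec j) (cong (m ℕ.*_) (sym (f≗g (1 ℕ.+ j)))))

pellNorm : ℤ → ℤ → ℤ → ℤ
pellNorm K X Y = X ℤ.* X ℤ.- K ℤ.* (Y ℤ.* Y)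

IsPellSolution : ℕ → ℕ × ℕ → Set
IsPellSolution k (X , Y) = pellNorm (+ k) (+ X) (+ Y) ≡ + 1

pellNorm-pos : ∀ k X Y → + (X ℕ.* X) ℤ.- + k ℤ.* + (Y ℕ.* Y) ≡ pellNorm (+ k) (+ X) (+ Y)
pellNorm-pos k X Y = cong₂ (λ X² Y² → X² ℤ.- + k ℤ.* Y²) (ℤₚ.pos-* X X) (ℤₚ.pos-* Y Y)

-- (X, Y) stands for X + Y√K: the norm is multiplicative, also against the conjugate
-- A − C√K, and (A + C√K)(A − C√K) = pellNorm K A C. The ring solver does not unfold
-- pellNorm, hence the expanded restatements.
module _ where
  open import Data.Integer using (_+_; _*_; _-_)

  pellNorm-* : ∀ K A C X Y → pellNorm K (A * X + K * C * Y) (C * X + A * Y) ≡ pellNorm K A C * pellNorm K X Y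
  pellNorm-* = expanded
    where
    expanded : ∀ K A C X Y → (A * X + K * C * Y) * (A * X + K * C * Y) - K * ((C * X + A * Y) * (C * X + A * Y))
                           ≡ (A * A - K * (C * C)) * (X * X - K * (Y * Y))
    expanded = solve-∀

  pellNorm-*-conj : ∀ K A C X Y → pellNorm K (A * X - K * C * Y) (A * Y - C * X) ≡ pellNorm K A C * pellNorm K X Y
  pellNorm-*-conj = expanded
    where
    expanded : ∀ K A C X Y → (A * X - K * C * Y) * (A * X - K * C * Y) - K * ((A * Y - C * X) * (A * Y - C * X))
                           ≡ (A * A - K * (C * C)) * (X * X - K * (Y * Y))
    expanded = solve-∀

  *-conj₁ : ∀ K A C X Y → A * (A * X - K * C * Y) + K * C * (A * Y - C * X) ≡ pellNorm K A C * X
  *-conj₁ = expanded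
    where
    expanded : ∀ K A C X Y → A * (A * X - K * C * Y) + K * C * (A * Y - C * X) ≡ (A * A - K * (C * C)) * X
    expanded = solve-∀

  *-conj₂ : ∀ K A C X Y → C * (A * X - K * C * Y) + A * (A * Y - C * X) ≡ pellNorm K A C * Y
  *-conj₂ = expanded
    where
    expanded : ∀ K A C X Y → C * (A * X - K * C * Y) + A * (A * Y - C * X) ≡ (A * A - K * (C * C)) * Y
    expanded = solve-∀

  x-y≡1⇒x≡1+y : ∀ {x y} → x - y ≡ + 1 → x ≡ + 1 + y
  x-y≡1⇒x≡1+y {x} {y} x-y≡1 = trans (identity x y) (cong (_+ y) x-y≡1)
    where
    identity : ∀ x y → x ≡ (x - y) + y
    identity = solve-∀

module _ {k : ℕ} .{{_ : NonZero k}} where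
  open import Data.Nat using (_+_; _*_)

  isPellSolution⇒ : ∀ {X Y} → IsPellSolution k (X , Y) → X * X ≡ 1 + k * (Y * Y)
  isPellSolution⇒ {X = X} {Y = Y} sol = ℤₚ.+-injective (begin
      + (X * X)                          ≡⟨ ℤₚ.pos-* X X ⟩
      + X ℤ.* + X                         ≡⟨ x-y≡1⇒x≡1+y {+ X ℤ.* + X} sol ⟩
      + 1 ℤ.+ + k ℤ.* (+ Y ℤ.* + Y)       ≡⟨ cong (λ Y² → + 1 ℤ.+ + k ℤ.* Y²) (ℤₚ.pos-* Y Y) ⟨
      + 1 ℤ.+ + k ℤ.* + (Y * Y)           ≡⟨ cong (ℤ._+_ (+ 1)) (ℤₚ.pos-* k (Y * Y)) ⟨
      + (1 + k * (Y * Y))                ∎)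
    where open ≡-Reasoning

  isPellSolution⇒Y<X : ∀ {X Y} → IsPellSolution k (X , Y) → Y < X
  isPellSolution⇒Y<X {X} {Y} sol = m*m<n*n⇒m<n (begin-strict
      Y * Y             ≤⟨ ℕₚ.m≤n*m (Y * Y) k ⟩
      k * (Y * Y)       <⟨ ℕₚ.n<1+n _ ⟩
      1 + k * (Y * Y)   ≡⟨ isPellSolution⇒ {X = X} {Y = Y} sol ⟨
      X * X             ∎)
    where open ℕₚ.≤-Reasoning

module FundamentalSolution {k : ℕ} .{{_ : NonZero k}} {a c : ℕ}
                           (ac-solution : IsPellSolution k (a , c)) (2≤a : 2 ≤ a) where
  open import Data.Nat using (_+_; _*_; _∸_; _^_)

  private
    A C K : ℤ
    A = + a
    C = + c
    K = + k

    instance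
      a≢0 : NonZero a
      a≢0 = ℕ.>-nonZero (ℕₚ.<-trans (s≤s z≤n) 2≤a)

    a*a≡1+k*[c*c] : a * a ≡ 1 + k * (c * c)
    a*a≡1+k*[c*c] = isPellSolution⇒ {X = a} {Y = c} ac-solution

  step unstep : ℕ × ℕ → ℕ × ℕ
  step   (X , Y) = a * X + k * c * Y , c * X + a * Y
  unstep (X , Y) = a * X ∸ k * c * Y , a * Y ∸ c * X

  power : ℕ → ℕ × ℕ
  power zero    = 1 , 0
  power (suc j) = step (power j)

  P Q : ℕ → ℕ
  P j = proj₁ (power j)
  Q j = proj₂ (power j)

  pos-step₁ : ∀ X Y → + (a * X + k * c * Y) ≡ A ℤ.* + X ℤ.+ K ℤ.* C ℤ.* + Y
  pos-step₁ X Y = trans (ℤₚ.pos-+ (a * X) (k * c * Y))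
    (cong₂ ℤ._+_ (ℤₚ.pos-* a X) (trans (ℤₚ.pos-* (k * c) Y) (cong (ℤ._* + Y) (ℤₚ.pos-* k c))))

  pos-step₂ : ∀ X Y → + (c * X + a * Y) ≡ C ℤ.* + X ℤ.+ A ℤ.* + Y
  pos-step₂ X Y = trans (ℤₚ.pos-+ (c * X) (a * Y)) (cong₂ ℤ._+_ (ℤₚ.pos-* c X) (ℤₚ.pos-* a Y))

  step-solution : ∀ {v} → IsPellSolution k v → IsPellSolution k (step v)
  step-solution {X , Y} sol = begin
      pellNorm K (+ (a * X + k * c * Y)) (+ (c * X + a * Y))
    ≡⟨ cong₂ (pellNorm K) (pos-step₁ X Y) (pos-step₂ X Y) ⟩
      pellNorm K (A ℤ.* + X ℤ.+ K ℤ.* C ℤ.* + Y) (C ℤ.* + X ℤ.+ A ℤ.* + Y)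
    ≡⟨ pellNorm-* K A C (+ X) (+ Y) ⟩
      pellNorm K A C ℤ.* pellNorm K (+ X) (+ Y)
    ≡⟨ cong₂ ℤ._*_ ac-solution sol ⟩
      + 1
    ∎
    where open ≡-Reasoning

  power-solution : ∀ j → IsPellSolution k (power j)
  power-solution zero    = cong (ℤ._-_ (+ 1)) (ℤₚ.*-zeroʳ K)
  power-solution (suc j) = step-solution (power-solution j)

  k*c*Y<a*X : ∀ {X Y} → IsPellSolution k (X , Y) → k * c * Y < a * X
  k*c*Y<a*X {X} {Y} sol = m*m<n*n⇒m<n (begin-strict
      k * c * Y * (k * c * Y)                              ≤⟨ ℕₚ.m≤n+m _ (k * (Y * Y) + k * (c * c)) ⟩
      k * (Y * Y) + k * (c * c) + k * c * Y * (k * c * Y)  <⟨ ℕₚ.n<1+n _ ⟩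
      1 + (k * (Y * Y) + k * (c * c) + k * c * Y * (k * c * Y))
        ≡⟨ ℕ-Solver.solve (k ∷ c ∷ X ∷ Y ∷ []) ⟩
      (1 + k * (c * c)) * (1 + k * (Y * Y))
        ≡⟨ cong₂ _*_ a*a≡1+k*[c*c] (isPellSolution⇒ {X = X} {Y = Y} sol) ⟨
      a * a * (X * X)                                      ≡⟨ ℕ-Solver.solve (a ∷ X ∷ []) ⟩
      a * X * (a * X)                                      ∎)
    where open ℕₚ.≤-Reasoning

  module _ {X Y : ℕ} (sol : IsPellSolution k (X , Y)) (a≤X : a ≤ X) where

    c≤Y : c ≤ Y
    c≤Y = m*m≤n*n⇒m≤n (ℕₚ.*-cancelˡ-≤ k (ℕₚ.+-cancelˡ-≤ 1 _ _
            (subst₂ _≤_ a*a≡1+k*[c*c] (isPellSolution⇒ {X = X} {Y = Y} sol) (ℕₚ.*-mono-≤ a≤X a≤X))))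

    c*X≤a*Y : c * X ≤ a * Y
    c*X≤a*Y = m*m≤n*n⇒m≤n (begin
        c * X * (c * X)                ≡⟨ ℕ-Solver.solve (c ∷ X ∷ []) ⟩
        c * c * (X * X)                ≡⟨ cong (c * c *_) (isPellSolution⇒ {X = X} {Y = Y} sol) ⟩
        c * c * (1 + k * (Y * Y))      ≡⟨ ℕ-Solver.solve (c ∷ k ∷ Y ∷ []) ⟩
        c * c + k * (c * c) * (Y * Y)  ≤⟨ ℕₚ.+-monoˡ-≤ _ (ℕₚ.*-mono-≤ c≤Y c≤Y) ⟩
        Y * Y + k * (c * c) * (Y * Y)  ≡⟨ ℕ-Solver.solve (c ∷ k ∷ Y ∷ []) ⟩
        (1 + k * (c * c)) * (Y * Y)    ≡⟨ cong (_* (Y * Y)) a*a≡1+k*[c*c] ⟨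
        a * a * (Y * Y)                ≡⟨ ℕ-Solver.solve (a ∷ Y ∷ []) ⟩
        a * Y * (a * Y)                ∎)
      where open ℕₚ.≤-Reasoning

    private
      X′ Y′ : ℕ
      X′ = proj₁ (unstep (X , Y))
      Y′ = proj₂ (unstep (X , Y))

      pos-X′ : + X′ ≡ A ℤ.* + X ℤ.- K ℤ.* C ℤ.* + Y
      pos-X′ = trans (pos-∸ (ℕₚ.<⇒≤ (k*c*Y<a*X sol)))
        (cong₂ ℤ._-_ (ℤₚ.pos-* a X) (trans (ℤₚ.pos-* (k * c) Y) (cong (ℤ._* + Y) (ℤₚ.pos-* k c))))

      pos-Y′ : + Y′ ≡ A ℤ.* + Y ℤ.- C ℤ.* + X
      pos-Y′ = trans (pos-∸ c*X≤a*Y) (cong₂ ℤ._-_ (ℤₚ.pos-* a Y) (ℤₚ.pos-* c X))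

    unstep-solution : IsPellSolution k (unstep (X , Y))
    unstep-solution = begin
        pellNorm K (+ X′) (+ Y′)
      ≡⟨ cong₂ (pellNorm K) pos-X′ pos-Y′ ⟩
        pellNorm K (A ℤ.* + X ℤ.- K ℤ.* C ℤ.* + Y) (A ℤ.* + Y ℤ.- C ℤ.* + X)
      ≡⟨ pellNorm-*-conj K A C (+ X) (+ Y) ⟩
        pellNorm K A C ℤ.* pellNorm K (+ X) (+ Y)
      ≡⟨ cong₂ ℤ._*_ ac-solution sol ⟩
        + 1
      ∎
      where open ≡-Reasoning

    step∘unstep : step (unstep (X , Y)) ≡ (X , Y)
    step∘unstep = cong₂ _,_ (ℤₚ.+-injective (begin
        + (a * X′ + k * c * Y′)                     ≡⟨ pos-step₁ X′ Y′ ⟩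
        A ℤ.* + X′ ℤ.+ K ℤ.* C ℤ.* + Y′
          ≡⟨ cong₂ (λ X″ Y″ → A ℤ.* X″ ℤ.+ K ℤ.* C ℤ.* Y″) pos-X′ pos-Y′ ⟩
        A ℤ.* (A ℤ.* + X ℤ.- K ℤ.* C ℤ.* + Y) ℤ.+ K ℤ.* C ℤ.* (A ℤ.* + Y ℤ.- C ℤ.* + X)
          ≡⟨ *-conj₁ K A C (+ X) (+ Y) ⟩
        pellNorm K A C ℤ.* + X                      ≡⟨ cong (ℤ._* + X) ac-solution ⟩
        + 1 ℤ.* + X                                 ≡⟨ ℤₚ.*-identityˡ (+ X) ⟩
        + X                                         ∎))
      (ℤₚ.+-injective (begin
        + (c * X′ + a * Y′)                         ≡⟨ pos-step₂ X′ Y′ ⟩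
        C ℤ.* + X′ ℤ.+ A ℤ.* + Y′
          ≡⟨ cong₂ (λ X″ Y″ → C ℤ.* X″ ℤ.+ A ℤ.* Y″) pos-X′ pos-Y′ ⟩
        C ℤ.* (A ℤ.* + X ℤ.- K ℤ.* C ℤ.* + Y) ℤ.+ A ℤ.* (A ℤ.* + Y ℤ.- C ℤ.* + X)
          ≡⟨ *-conj₂ K A C (+ X) (+ Y) ⟩
        pellNorm K A C ℤ.* + Y                      ≡⟨ cong (ℤ._* + Y) ac-solution ⟩
        + 1 ℤ.* + Y                                 ≡⟨ ℤₚ.*-identityˡ (+ Y) ⟩
        + Y                                         ∎))
      where open ≡-Reasoning

    unstep-< : X′ < X
    unstep-< = begin-strict
        X′                  <⟨ ℕₚ.m<m*n X′ a 2≤a ⟩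
        X′ * a              ≡⟨ ℕₚ.*-comm X′ a ⟩
        a * X′              ≤⟨ ℕₚ.m≤m+n (a * X′) (k * c * Y′) ⟩
        a * X′ + k * c * Y′ ≡⟨ cong proj₁ step∘unstep ⟩
        X                   ∎
      where
      open ℕₚ.≤-Reasoning
      instance
        X′≢0 : NonZero X′
        X′≢0 = ℕ.>-nonZero (ℕₚ.m<n⇒0<n∸m (k*c*Y<a*X sol))

  trivialSolution : ∀ {X Y} → Y < X → X < 2 → (1 , 0) ≡ (X , Y)
  trivialSolution (s≤s z≤n) (s≤s (s≤s z≤n)) = refl

  solution⇒power : (∀ X Y → IsPellSolution k (X , Y) → 2 ≤ X → a ≤ X) →
                   ∀ X Y → IsPellSolution k (X , Y) → ∃ λ j → power j ≡ (X , Y)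
  solution⇒power minimal X _ = descend (<-wellFounded X)
    where
    descend : ∀ {X Y} → Acc _<_ X → IsPellSolution k (X , Y) → ∃ λ j → power j ≡ (X , Y)
    descend {X} {Y} (acc smaller) sol with 2 ≤? X
    ... | no X≱2  = 0 , trivialSolution (isPellSolution⇒Y<X sol) (ℕₚ.≰⇒> X≱2)
    ... | yes 2≤X = map suc (λ eq → trans (cong step eq) (step∘unstep sol a≤X))
                            (descend (smaller (unstep-< sol a≤X)) (unstep-solution sol a≤X))
      where
      a≤X : a ≤ X
      a≤X = minimal X Y sol 2≤X

  Q<P : ∀ j → Q j < P j
  Q<P j = isPellSolution⇒Y<X (power-solution j)

  P-< : P Preserves _<_ ⟶ _<_
  P-< = <-suc⇒strictMono λ j → begin-strict
      P j                     <⟨ ℕₚ.m<m*n (P j) a {{ℕ.>-nonZero (ℕₚ.≤-<-trans z≤n (Q<P j))}} 2≤a ⟩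
      P j * a                 ≡⟨ ℕₚ.*-comm (P j) a ⟩
      a * P j                 ≤⟨ ℕₚ.m≤m+n (a * P j) (k * c * Q j) ⟩
      P (suc j)               ∎
    where open ℕₚ.≤-Reasoning

  Q-≤-suc : ∀ j → Q j ≤ Q (suc j)
  Q-≤-suc j = ℕₚ.≤-trans (ℕₚ.m≤n*m (Q j) a) (ℕₚ.m≤n+m (a * Q j) (c * P j))

  P≤[2a]^ : ∀ j → P j ≤ (2 * a) ^ j
  P≤[2a]^ zero    = ℕₚ.≤-refl
  P≤[2a]^ (suc j) = begin
      a * P j + k * c * Q j  ≤⟨ ℕₚ.+-monoʳ-≤ (a * P j) (ℕₚ.<⇒≤ (k*c*Y<a*X (power-solution j))) ⟩
      a * P j + a * P j      ≡⟨ double a (P j) ⟩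
      2 * a * P j            ≤⟨ ℕₚ.*-monoʳ-≤ (2 * a) (P≤[2a]^ j) ⟩
      2 * a * (2 * a) ^ j    ∎
    where
    open ℕₚ.≤-Reasoning
    double : ∀ a p → a * p + a * p ≡ 2 * a * p
    double = ℕ-Solver.solve-∀

  -- The matrix of step has trace 2a and determinant a² − k c² = 1 (Cayley–Hamilton).
  step²-trace₁ : ∀ X Y → a * (a * X + k * c * Y) + k * c * (c * X + a * Y) + X ≡ 2 * a * (a * X + k * c * Y)
  step²-trace₁ X Y = begin
      a * (a * X + k * c * Y) + k * c * (c * X + a * Y) + X
    ≡⟨ ℕ-Solver.solve (a ∷ c ∷ k ∷ X ∷ Y ∷ []) ⟩
      a * a * X + (1 + k * (c * c)) * X + 2 * a * k * c * Y
    ≡⟨ cong (λ t → a * a * X + t * X + 2 * a * k * c * Y) a*a≡1+k*[c*c] ⟨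
      a * a * X + a * a * X + 2 * a * k * c * Y
    ≡⟨ ℕ-Solver.solve (a ∷ c ∷ k ∷ X ∷ Y ∷ []) ⟩
      2 * a * (a * X + k * c * Y)
    ∎
    where open ≡-Reasoning

  step²-trace₂ : ∀ X Y → c * (a * X + k * c * Y) + a * (c * X + a * Y) + Y ≡ 2 * a * (c * X + a * Y)
  step²-trace₂ X Y = begin
      c * (a * X + k * c * Y) + a * (c * X + a * Y) + Y
    ≡⟨ ℕ-Solver.solve (a ∷ c ∷ k ∷ X ∷ Y ∷ []) ⟩
      2 * a * c * X + a * a * Y + (1 + k * (c * c)) * Y
    ≡⟨ cong (λ t → 2 * a * c * X + a * a * Y + t * Y) a*a≡1+k*[c*c] ⟨
      2 * a * c * X + a * a * Y + a * a * Y
    ≡⟨ ℕ-Solver.solve (a ∷ c ∷ X ∷ Y ∷ []) ⟩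
      2 * a * (c * X + a * Y)
    ∎
    where open ≡-Reasoning

  P-recurrence : ∀ j → P (2 + j) + P j ≡ 2 * a * P (1 + j)
  P-recurrence j = step²-trace₁ (P j) (Q j)

  Q-recurrence : ∀ j → Q (2 + j) + Q j ≡ 2 * a * Q (1 + j)
  Q-recurrence j = step²-trace₂ (P j) (Q j)

-- c^(n+2) times the numerator and c² times the denominator of
-- Σ u i z^i = (u₀ + (u₁ − m u₀) z) / (1 − m z + z²) at z = 1/c.
numerator : ℕ → ℕ → ℕ → ℕ → ℕ → ℤ
numerator m u₀ u₁ c n = (+ c) ℤ.^ (2 ℕ.+ n) ℤ.* + u₀ ℤ.+ (+ c) ℤ.^ (1 ℕ.+ n) ℤ.* (+ u₁ ℤ.- + m ℤ.* + u₀)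

denominator : ℕ → ℕ → ℤ
denominator m c = + c ℤ.* + c ℤ.- + m ℤ.* + c ℤ.+ + 1

denominator≡ : ∀ {m c} → m ≤ c → denominator m c ≡ + suc (c ℕ.* (c ℕ.∸ m))
denominator≡ {m} {c} m≤c = begin
    C * C - M * C + + 1        ≡⟨ factor C M ⟩
    + 1 + C * (C - M)          ≡⟨ cong (λ e → + 1 + C * e) (pos-∸ m≤c) ⟨
    + 1 + C * + (c ℕ.∸ m)      ≡⟨ cong (_+_ (+ 1)) (ℤₚ.pos-* c (c ℕ.∸ m)) ⟨
    + 1 + + (c ℕ.* (c ℕ.∸ m))  ≡⟨ ℤₚ.pos-+ 1 (c ℕ.* (c ℕ.∸ m)) ⟨
    + suc (c ℕ.* (c ℕ.∸ m))    ∎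
  where
  open ≡-Reasoning
  open import Data.Integer using (_+_; _*_; _-_)
  C M : ℤ
  C = + c
  M = + m
  factor : ∀ C M → C * C - M * C + + 1 ≡ + 1 + C * (C - M)
  factor = solve-∀

module SecondOrderRecurrence (m : ℕ) (u : ℕ → ℕ) (u-rec : ∀ j → u (2 ℕ.+ j) ℕ.+ u j ≡ m ℕ.* u (1 ℕ.+ j)) where

  horner : ℕ → ℕ → ℕ
  horner c zero    = u 0
  horner c (suc n) = horner c n ℕ.* c ℕ.+ u (suc n)

  horner-mod : ∀ c .{{_ : NonZero c}} n → u n < c → horner c n % c ≡ u n
  horner-mod c zero    u₀<c = m<n⇒m%n≡m u₀<c
  horner-mod c (suc n) uₙ<c = begin
      (horner c n ℕ.* c ℕ.+ u (suc n)) % c  ≡⟨ cong (_% c) (ℕₚ.+-comm (horner c n ℕ.* c) (u (suc n))) ⟩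
      (u (suc n) ℕ.+ horner c n ℕ.* c) % c  ≡⟨ [m+kn]%n≡m%n (u (suc n)) (horner c n) c ⟩
      u (suc n) % c                         ≡⟨ m<n⇒m%n≡m uₙ<c ⟩
      u (suc n)                             ∎
    where open ≡-Reasoning

  u-recℤ : ∀ j → + u (2 ℕ.+ j) ≡ + m ℤ.* + u (1 ℕ.+ j) ℤ.- + u j
  u-recℤ j = begin
      + u (2 ℕ.+ j)                          ≡⟨ x≡[x+y]-y (+ u (2 ℕ.+ j)) (+ u j) ⟩
      + u (2 ℕ.+ j) ℤ.+ + u j ℤ.- + u j      ≡⟨ cong (ℤ._- + u j) (ℤₚ.pos-+ (u (2 ℕ.+ j)) (u j)) ⟨
      + (u (2 ℕ.+ j) ℕ.+ u j) ℤ.- + u j      ≡⟨ cong (λ v → + v ℤ.- + u j) (u-rec j) ⟩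
      + (m ℕ.* u (1 ℕ.+ j)) ℤ.- + u j        ≡⟨ cong (ℤ._- + u j) (ℤₚ.pos-* m (u (1 ℕ.+ j))) ⟩
      + m ℤ.* + u (1 ℕ.+ j) ℤ.- + u j        ∎
    where
    open ≡-Reasoning
    open import Data.Integer using (_+_; _-_)
    x≡[x+y]-y : ∀ x y → x ≡ x + y - y
    x≡[x+y]-y = solve-∀

  horner-truncation : ∀ c n → denominator m c ℤ.* + horner c n ℤ.+ (+ u (1 ℕ.+ n) ℤ.* + c ℤ.- + u n)
                              ≡ numerator m (u 0) (u 1) c n
  horner-truncation c zero    = base (+ c) (+ m) (+ u 0) (+ u 1)
    where
    open import Data.Integer using (_+_; _*_; _-_)
    base : ∀ C M U₀ U₁ → (C * C - M * C + + 1) * U₀ + (U₁ * C - U₀)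
                       ≡ C * (C * + 1) * U₀ + C * + 1 * (U₁ - M * U₀)
    base = solve-∀
  horner-truncation c (suc n) = begin
      D * + horner c (suc n) + (+ u (2 ℕ.+ n) * C - + u (1 ℕ.+ n))
    ≡⟨ cong₂ (λ h v → D * h + (v * C - + u (1 ℕ.+ n))) pos-horner (u-recℤ n) ⟩
      D * (+ horner c n * C + + u (1 ℕ.+ n)) + ((M * + u (1 ℕ.+ n) - + u n) * C - + u (1 ℕ.+ n))
    ≡⟨ shift C M (+ horner c n) (+ u (1 ℕ.+ n)) (+ u n) ⟩
      C * (D * + horner c n + (+ u (1 ℕ.+ n) * C - + u n))
    ≡⟨ cong (C *_) (horner-truncation c n) ⟩
      C * (C ^ (2 ℕ.+ n) * + u 0 + C ^ (1 ℕ.+ n) * (+ u 1 - M * + u 0))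
    ≡⟨ ℤₚ.*-distribˡ-+ C _ _ ⟩
      C * (C ^ (2 ℕ.+ n) * + u 0) + C * (C ^ (1 ℕ.+ n) * (+ u 1 - M * + u 0))
    ≡⟨ cong₂ _+_ (ℤₚ.*-assoc C _ _) (ℤₚ.*-assoc C _ _) ⟨
      numerator m (u 0) (u 1) c (suc n)
    ∎
    where
    open ≡-Reasoning
    open import Data.Integer using (_+_; _*_; _-_; _^_)
    C M D : ℤ
    C = + c
    M = + m
    D = denominator m c
    pos-horner : + horner c (suc n) ≡ + horner c n * C + + u (1 ℕ.+ n)
    pos-horner = trans (ℤₚ.pos-+ (horner c n ℕ.* c) (u (suc n))) (cong (_+ + u (suc n)) (ℤₚ.pos-* (horner c n) c))
    shift : ∀ C M H V W → (C * C - M * C + + 1) * (H * C + V) + ((M * V - W) * C - V)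
                        ≡ C * ((C * C - M * C + + 1) * H + (V * C - W))
    shift = solve-∀

  digit-extraction : ∀ c n → 1 ≤ m → u (1 ℕ.+ n) ℕ.+ m ≤ c → u n ≤ u (1 ℕ.+ n) →
                     u n ≡ floorDiv (numerator m (u 0) (u 1) c n) (denominator m c) modℕ' c
  digit-extraction zero        n 1≤m small _    = contradiction (ℕₚ.m+n≤o⇒n≤o _ small) (ℕₚ.<⇒≱ 1≤m)
  digit-extraction c@(suc _) n 1≤m small mono = sym (begin
      floorDiv (numerator m (u 0) (u 1) c n) (denominator m c) modℕ' c
    ≡⟨ cong₂ (λ N D → floorDiv N D modℕ' c) numerator≡ (denominator≡ m≤c) ⟩
      ((r ℕ.+ horner c n ℕ.* d) / d) % c
    ≡⟨ cong (_% c) ([m+kn]/n≡k (horner c n) d r<d) ⟩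
      horner c n % c
    ≡⟨ horner-mod c n uₙ<c ⟩
      u n
    ∎)
    where
    open ≡-Reasoning
    d r : ℕ
    d = suc (c ℕ.* (c ℕ.∸ m))
    r = u (1 ℕ.+ n) ℕ.* c ℕ.∸ u n

    m≤c : m ≤ c
    m≤c = ℕₚ.m+n≤o⇒n≤o (u (1 ℕ.+ n)) small

    uₙ<c : u n < c
    uₙ<c = ℕₚ.≤-<-trans mono (ℕₚ.<-≤-trans (ℕₚ.m<m+n (u (1 ℕ.+ n)) 1≤m) small)

    r<d : r < d
    r<d = s≤s (ℕₚ.≤-trans (ℕₚ.m∸n≤m _ (u n))
                (ℕₚ.≤-trans (ℕₚ.*-monoˡ-≤ c (ℕₚ.m+n≤o⇒m≤o∸n (u (1 ℕ.+ n)) small))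
                  (ℕₚ.≤-reflexive (ℕₚ.*-comm (c ℕ.∸ m) c))))

    pos-r : + r ≡ + u (1 ℕ.+ n) ℤ.* + c ℤ.- + u n
    pos-r = trans (pos-∸ (ℕₚ.≤-trans mono (ℕₚ.m≤m*n (u (1 ℕ.+ n)) c)))
                  (cong (ℤ._- + u n) (ℤₚ.pos-* (u (1 ℕ.+ n)) c))

    numerator≡ : numerator m (u 0) (u 1) c n ≡ + (r ℕ.+ horner c n ℕ.* d)
    numerator≡ = begin
        numerator m (u 0) (u 1) c n
      ≡⟨ horner-truncation c n ⟨
        denominator m c ℤ.* + horner c n ℤ.+ (+ u (1 ℕ.+ n) ℤ.* + c ℤ.- + u n)
      ≡⟨ cong₂ (λ D r′ → D ℤ.* + horner c n ℤ.+ r′) (denominator≡ m≤c) (sym pos-r) ⟩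
        + d ℤ.* + horner c n ℤ.+ + r
      ≡⟨ ℤₚ.+-comm (+ d ℤ.* + horner c n) (+ r) ⟩
        + r ℤ.+ + d ℤ.* + horner c n
      ≡⟨ cong (ℤ._+_ (+ r)) (ℤₚ.*-comm (+ d) (+ horner c n)) ⟩
        + r ℤ.+ + horner c n ℤ.* + d
      ≡⟨ cong (ℤ._+_ (+ r)) (ℤₚ.pos-* (horner c n) d) ⟨
        + r ℤ.+ + (horner c n ℕ.* d)
      ≡⟨ ℤₚ.pos-+ r (horner c n ℕ.* d) ⟨
        + (r ℕ.+ horner c n ℕ.* d)
      ∎

n*n+2n≡n*[2+n] : ∀ n → n ℕ.* n ℕ.+ 2 ℕ.* n ≡ n ℕ.* (2 ℕ.+ n)
n*n+2n≡n*[2+n] = ℕ-Solver.solve-∀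

n*n+n≡n*[1+n] : ∀ n → n ℕ.* n ℕ.+ n ≡ n ℕ.* (1 ℕ.+ n)
n*n+n≡n*[1+n] = ℕ-Solver.solve-∀

numerator-base₁ : ∀ b n {u₀} u₁ → u₀ ≡ 1 → numerator (2 ℕ.* u₁) u₀ u₁ (b ℕ.^ n) n
                  ≡ (+ b) ℤ.^ (n ℕ.* n ℕ.+ 2 ℕ.* n) ℤ.- + u₁ ℤ.* (+ b) ℤ.^ (n ℕ.* n ℕ.+ n)
numerator-base₁ b n u₁ refl = begin
    C ^ (2 ℕ.+ n) * + 1 + C ^ (1 ℕ.+ n) * (+ u₁ - + (2 ℕ.* u₁) * + 1)
  ≡⟨ cong (λ M → C ^ (2 ℕ.+ n) * + 1 + C ^ (1 ℕ.+ n) * (+ u₁ - M * + 1)) (ℤₚ.pos-* 2 u₁) ⟩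
    C ^ (2 ℕ.+ n) * + 1 + C ^ (1 ℕ.+ n) * (+ u₁ - + 2 * + u₁ * + 1)
  ≡⟨ collapse (C ^ (2 ℕ.+ n)) (C ^ (1 ℕ.+ n)) (+ u₁) ⟩
    C ^ (2 ℕ.+ n) - + u₁ * C ^ (1 ℕ.+ n)
  ≡⟨ cong₂ (λ T₂ T₁ → T₂ - + u₁ * T₁) (pos-^-* b n (n*n+2n≡n*[2+n] n)) (pos-^-* b n (n*n+n≡n*[1+n] n)) ⟨
    (+ b) ^ (n ℕ.* n ℕ.+ 2 ℕ.* n) - + u₁ * (+ b) ^ (n ℕ.* n ℕ.+ n)
  ∎
  where
  open ≡-Reasoning
  open import Data.Integer using (_+_; _*_; _-_; _^_)
  C : ℤ
  C = + (b ℕ.^ n)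
  collapse : ∀ T₂ T₁ U → T₂ * + 1 + T₁ * (U - + 2 * U * + 1) ≡ T₂ - U * T₁
  collapse = solve-∀

numerator-base₀ : ∀ b n m {u₀} u₁ → u₀ ≡ 0 →
  numerator m u₀ u₁ (b ℕ.^ n) n ≡ + u₁ ℤ.* (+ b) ℤ.^ (n ℕ.* n ℕ.+ n)
numerator-base₀ b n m u₁ refl = begin
    C ^ (2 ℕ.+ n) * + 0 + C ^ (1 ℕ.+ n) * (+ u₁ - + m * + 0)
  ≡⟨ collapse (C ^ (2 ℕ.+ n)) (C ^ (1 ℕ.+ n)) (+ u₁) (+ m) ⟩
    + u₁ * C ^ (1 ℕ.+ n)
  ≡⟨ cong (+ u₁ *_) (pos-^-* b n (n*n+n≡n*[1+n] n)) ⟨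
    + u₁ * (+ b) ^ (n ℕ.* n ℕ.+ n)
  ∎
  where
  open ≡-Reasoning
  open import Data.Integer using (_+_; _*_; _-_; _^_)
  C : ℤ
  C = + (b ℕ.^ n)
  collapse : ∀ T₂ T₁ U M → T₂ * + 0 + T₁ * (U - M * + 0) ≡ U * T₁
  collapse = solve-∀

denominator-base : ∀ b n a →
  denominator (2 ℕ.* a) (b ℕ.^ n) ≡ (+ b) ℤ.^ (2 ℕ.* n) ℤ.- + 2 ℤ.* + a ℤ.* (+ b) ℤ.^ n ℤ.+ + 1
denominator-base b n a = cong₂ (λ S T → S ℤ.- T ℤ.+ + 1) square (cong₂ ℤ._*_ (ℤₚ.pos-* 2 a) (pos-^ b n))
  where
  C : ℤ
  C = + (b ℕ.^ n)
  square : C ℤ.* C ≡ (+ b) ℤ.^ (2 ℕ.* n)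
  square = sym (trans (pos-^-* b n (ℕₚ.*-comm 2 n)) (cong (C ℤ.*_) (ℤₚ.*-identityʳ C)))

m^[1+n]+m≤b^n : ∀ {m b} → 1 ≤ m → m ℕ.* m ℕ.+ m ≤ b →
                ∀ {n} → 1 ≤ n → m ℕ.^ (1 ℕ.+ n) ℕ.+ m ≤ b ℕ.^ n
m^[1+n]+m≤b^n {m} {b} 1≤m m*m+m≤b {suc zero} _ =
  subst₂ _≤_ (cong (λ t → m ℕ.* t ℕ.+ m) (sym (ℕₚ.*-identityʳ m))) (sym (ℕₚ.*-identityʳ b)) m*m+m≤b
m^[1+n]+m≤b^n {m} {b} 1≤m m*m+m≤b {suc (suc n)} _ = begin
    m ^ (3 + n) + m        ≤⟨ ℕₚ.+-monoʳ-≤ (m ^ (3 + n)) (ℕₚ.m≤m*n m m {{ℕ.>-nonZero 1≤m}}) ⟩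
    m ^ (3 + n) + m * m    ≡⟨ ℕₚ.*-distribˡ-+ m (m ^ (2 + n)) m ⟨
    m * (m ^ (2 + n) + m)  ≤⟨ ℕₚ.*-mono-≤ m≤b (m^[1+n]+m≤b^n 1≤m m*m+m≤b {suc n} (s≤s z≤n)) ⟩
    b * b ^ (1 + n)        ∎
  where
  open ℕₚ.≤-Reasoning
  open import Data.Nat using (_+_; _*_; _^_)
  m≤b : m ≤ b
  m≤b = ℕₚ.≤-trans (ℕₚ.m≤n+m m (m * m)) m*m+m≤b

module PellEnumeration {k : ℕ} .{{_ : NonZero k}} (x y : ℕ → ℕ)
  (enumerates : ∀ X Y → IsPellSolution k (X , Y) ⇔ (∃ λ n → x n ≡ X × y n ≡ Y))
  (x₀≡1 : x 0 ≡ 1) (x-< : x Preserves _<_ ⟶ _<_) where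
  open import Data.Nat using (_+_; _*_; _^_)

  2≤x₁ : 2 ≤ x 1
  2≤x₁ = subst (_< x 1) x₀≡1 (x-< (s≤s z≤n))

  enumerated-solution : ∀ n → IsPellSolution k (x n , y n)
  enumerated-solution n = Equivalence.from (enumerates (x n) (y n)) (n , refl , refl)

  private
    minimal : ∀ X Y → IsPellSolution k (X , Y) → 2 ≤ X → x 1 ≤ X
    minimal X Y sol 2≤X with Equivalence.to (enumerates X Y) sol
    ... | zero  , x₀≡X , _ = contradiction (trans (sym x₀≡1) x₀≡X) (ℕₚ.<⇒≢ 2≤X)
    ... | suc _ , refl , _ = strictMono⇒mono x-< (s≤s z≤n)

  open FundamentalSolution {a = x 1} {c = y 1} (enumerated-solution 1) 2≤x₁

  x≗P : x ≗ P
  x≗P = strictMono-sameRange⇒≗ x-< P-< x⊆P P⊆x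
    where
    x⊆P : ∀ i → ∃ λ j → x i ≡ P j
    x⊆P i = map₂ (λ eq → sym (cong proj₁ eq)) (solution⇒power minimal (x i) (y i) (enumerated-solution i))
    P⊆x : ∀ j → ∃ λ i → P j ≡ x i
    P⊆x j = map₂ (λ eqs → sym (proj₁ eqs)) (Equivalence.to (enumerates (P j) (Q j)) (power-solution j))

  y≗Q : y ≗ Q
  y≗Q n with solution⇒power minimal (x n) (y n) (enumerated-solution n)
  ... | j , eq = trans (sym (cong proj₂ eq)) (cong Q (strictMono⇒injective P-< {j} {n} (trans (cong proj₁ eq) (x≗P n))))

  m : ℕ
  m = 2 * x 1

  1≤m : 1 ≤ m
  1≤m = ℕₚ.≤-trans (ℕₚ.<⇒≤ 2≤x₁) (ℕₚ.m≤m+n (x 1) (x 1 + 0))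

  x-recurrence : ∀ j → x (2 + j) + x j ≡ m * x (1 + j)
  x-recurrence = recurrence-≗ {m = m} x≗P P-recurrence

  y-recurrence : ∀ j → y (2 + j) + y j ≡ m * y (1 + j)
  y-recurrence = recurrence-≗ {m = m} y≗Q Q-recurrence

  x-≤-suc : ∀ j → x j ≤ x (suc j)
  x-≤-suc j = strictMono⇒mono x-< (ℕₚ.n≤1+n j)

  y-≤-suc : ∀ j → y j ≤ y (suc j)
  y-≤-suc j = subst₂ _≤_ (sym (y≗Q j)) (sym (y≗Q (suc j))) (Q-≤-suc j)

  x[1+n]+m≤b^n : ∀ {b n} → m * m + m ≤ b → 1 ≤ n → x (1 + n) + m ≤ b ^ n
  x[1+n]+m≤b^n {n = n} m*m+m≤b 1≤n = ℕₚ.≤-trans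
    (ℕₚ.+-monoˡ-≤ m (subst (_≤ m ^ (1 + n)) (sym (x≗P (1 + n))) (P≤[2a]^ (1 + n))))
    (m^[1+n]+m≤b^n 1≤m m*m+m≤b 1≤n)

  y[1+n]+m≤b^n : ∀ {b n} → m * m + m ≤ b → 1 ≤ n → y (1 + n) + m ≤ b ^ n
  y[1+n]+m≤b^n {n = n} m*m+m≤b 1≤n = ℕₚ.≤-trans
    (ℕₚ.+-monoˡ-≤ m (ℕₚ.<⇒≤ (isPellSolution⇒Y<X {X = x (1 + n)} {Y = y (1 + n)} (enumerated-solution (1 + n)))))
    (x[1+n]+m≤b^n m*m+m≤b 1≤n)

corollary7p3 : (k : ℕ) → 1 ≤ k → (∀ m → m ℕ.* m ≢ k) →
    (x y : ℕ → ℕ) →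
    (∀ X Y → ((+ (X ℕ.* X)) ℤ.- (+ k) ℤ.* (+ (Y ℕ.* Y)) ≡ + 1) ⇔ (∃ λ n → x n ≡ X × y n ≡ Y)) →
    x 0 ≡ 1 → y 0 ≡ 0 →
    (∀ m n → m < n → x m < x n) →
    ∃ λ B → ∀ (b : ℕ) → B ≤ b → 2 ≤ b → ∀ (n : ℕ) → 1 ≤ n →
      let bb = + b
          D = bb ℤ.^ (2 ℕ.* n) ℤ.- (+ 2) ℤ.* (+ x 1) ℤ.* bb ℤ.^ n ℤ.+ + 1
      in (x n ≡ floorDiv (bb ℤ.^ (n ℕ.* n ℕ.+ 2 ℕ.* n) ℤ.- (+ x 1) ℤ.* bb ℤ.^ (n ℕ.* n ℕ.+ n)) D modℕ' (b ℕ.^ n))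
       × (y n ≡ floorDiv ((+ y 1) ℤ.* bb ℤ.^ (n ℕ.* n ℕ.+ n)) D modℕ' (b ℕ.^ n))
corollary7p3 k 1≤k _ x y enumerates x₀≡1 y₀≡0 x-< = m ℕ.* m ℕ.+ m , λ b m*m+m≤b _ n 1≤n →
    trans (X.digit-extraction (b ℕ.^ n) n 1≤m (x[1+n]+m≤b^n m*m+m≤b 1≤n) (x-≤-suc n))
          (cong₂ (λ N D → floorDiv N D modℕ' (b ℕ.^ n)) (numerator-base₁ b n (x 1) x₀≡1) (denominator-base b n (x 1))) ,
    trans (Y.digit-extraction (b ℕ.^ n) n 1≤m (y[1+n]+m≤b^n m*m+m≤b 1≤n) (y-≤-suc n))
          (cong₂ (λ N D → floorDiv N D modℕ' (b ℕ.^ n)) (numerator-base₀ b n m (y 1) y₀≡0) (denominator-base b n (x 1)))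
  where
  open PellEnumeration {{ℕ.>-nonZero 1≤k}} x y
    (λ X Y → subst (λ N → N ≡ + 1 ⇔ _) (pellNorm-pos k X Y) (enumerates X Y)) x₀≡1 (λ {i} {j} → x-< i j)
  module X = SecondOrderRecurrence m x x-recurrence
  module Y = SecondOrderRecurrence m y y-recurrence
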